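{- Every finite, simple, connected, undirected bipartite graph admits a robust maximal independent set.
   Context: A connected spanning subgraph of $G=(V,E_G)$ is a connected graph $H=(V,E_H)$ with $E_H\subseteq E_G$. A maximal independent set (MIS) is a set of pairwise non-adjacent vertices maximal for inclusion. An MIS $S$ of $G$ is robust if $S$ is a maximal independent set in every connected spanning subgraph of $G$ (including $G$ itself). -}

module Defs where

open import Data.Nat using (ℕ; zero; suc)
open import Data.Fin using (Fin)
open import Data.Bool using (Bool; true; false; T; not)
open import Data.Product using (Σ; _×_; _,_)
open import Relation.Binary.PropositionalEquality using (_≡_)
open import Relation.Nullary using (¬_)

record Graph (n : ℕ) : Set where
  field
    adj   : Fin n → Fin n → Bool
    sym   : ∀ u v → T (adj u v) → T (adj v u)
    irref : ∀ v → ¬ T (adj v v)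
open Graph public

data Walk {n : ℕ} (G : Graph n) : Fin n → Fin n → Set where
  here : ∀ {u} → Walk G u u
  step : ∀ {u v w} → T (adj G u v) → Walk G v w → Walk G u w

Connected : ∀ {n} → Graph n → Set
Connected G = ∀ u v → Walk G u v

Bipartite : ∀ {n} → Graph n → Set
Bipartite {n} G = Σ (Fin n → Bool) λ c → ∀ u v → T (adj G u v) → ¬ (c u ≡ c v)

SpanningSubgraph : ∀ {n} → Graph n → Graph n → Set
SpanningSubgraph H G = ∀ u v → T (adj H u v) → T (adj G u v)

VSet : ℕ → Set
VSet n = Fin n → Bool

_⊆_ : ∀ {n} → VSet n → VSet n → Set
S ⊆ S' = ∀ v → T (S v) → T (S' v)

Independent : ∀ {n} → Graph n → VSet n → Set
Independent G S = ∀ u v → T (S u) → T (S v) → ¬ T (adj G u v)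

MaximalIndependent : ∀ {n} → Graph n → VSet n → Set
MaximalIndependent G S =
  Independent G S × (∀ S' → Independent G S' → S ⊆ S' → S' ⊆ S)

Robust : ∀ {n} → Graph n → VSet n → Set
Robust G S = ∀ H → SpanningSubgraph H G → Connected H → MaximalIndependent H S

-- Fix a proper 2-colouring c of G and a vertex r, and let S be the colour class of r.
-- Every spanning subgraph H of G is properly coloured by c as well, so S is independent in H.
-- If H is connected, every vertex v ∉ S has a walk to r ∈ S in H; its first edge leads to a
-- neighbour of the other colour, which is the colour of r. So S dominates H, hence is maximal.
module Submission where

open import Defs hiding (sym)
open import Data.Nat using (ℕ; zero; suc)
open import Data.Fin using (Fin; zero)
open import Data.Bool using (Bool; T; not)
open import Data.Bool.Properties using (_≟_; ¬-not; not-involutive; T?)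
open import Data.Empty using (⊥-elim)
open import Data.Product using (Σ; ∃-syntax; _×_; _,_)
open import Relation.Binary.PropositionalEquality using (_≡_; _≢_; refl; sym; trans; cong)
open import Relation.Nullary using (¬_; yes; no)
open import Relation.Nullary.Decidable using (⌊_⌋; toWitness; fromWitness)

private
  variable
    n : ℕ

ProperColouring : Graph n → (Fin n → Bool) → Set
ProperColouring G c = ∀ u v → T (adj G u v) → c u ≢ c v

Dominating : Graph n → VSet n → Set
Dominating G S = ∀ v → ¬ T (S v) → ∃[ u ] T (adj G v u) × T (S u)

independent∧dominating⇒maximal : ∀ {G : Graph n} {S} →
  Independent G S → Dominating G S → MaximalIndependent G S
independent∧dominating⇒maximal {G = G} {S} indS domS = indS , maximal
  where
  maximal : ∀ S' → Independent G S' → S ⊆ S' → S' ⊆ S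
  maximal S' indS' S⊆S' v v∈S' with T? (S v)
  ... | yes v∈S = v∈S
  ... | no v∉S with domS v v∉S
  ...   | u , vu , u∈S = ⊥-elim (indS' v u v∈S' (S⊆S' u u∈S) vu)

walk-firstStep : ∀ {G : Graph n} {v w} → Walk G v w → v ≢ w → ∃[ u ] T (adj G v u)
walk-firstStep here                v≢v = ⊥-elim (v≢v refl)
walk-firstStep (step {v = u} vu _) _ = u , vu

ProperColouring-⊆ : ∀ {H G : Graph n} {c} →
  SpanningSubgraph H G → ProperColouring G c → ProperColouring H c
ProperColouring-⊆ H⊆G proper u v uv = proper u v (H⊆G u v uv)

colourClass : (Fin n → Bool) → Bool → VSet n
colourClass c b v = ⌊ c v ≟ b ⌋

colourClass⁻ : ∀ (c : Fin n → Bool) {b} v → T (colourClass c b v) → c v ≡ b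
colourClass⁻ c {b} v = toWitness {a? = c v ≟ b}

colourClass⁺ : ∀ (c : Fin n → Bool) {b} v → c v ≡ b → T (colourClass c b v)
colourClass⁺ c {b} v = fromWitness {a? = c v ≟ b}

colourClass-independent : ∀ {G : Graph n} c b →
  ProperColouring G c → Independent G (colourClass c b)
colourClass-independent c b proper u v u∈S v∈S uv =
  proper u v uv (trans (colourClass⁻ c u u∈S) (sym (colourClass⁻ c v v∈S)))

colourClass-dominating : ∀ {G : Graph n} c r →
  Connected G → ProperColouring G c → Dominating G (colourClass c (c r))
colourClass-dominating c r conn proper v v∉S
  with walk-firstStep (conn v r) (λ { refl → v∉S (colourClass⁺ c v refl) })
... | u , vu = u , vu , colourClass⁺ c u cu≡cr
  where
  cv≡not-cr : c v ≡ not (c r)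
  cv≡not-cr = ¬-not (λ cv≡cr → v∉S (colourClass⁺ c v cv≡cr))

  cu≡cr : c u ≡ c r
  cu≡cr = trans (¬-not (λ cu≡cv → proper v u vu (sym cu≡cv)))
                (trans (cong not cv≡not-cr) (not-involutive (c r)))

colourClass-robust : ∀ {G : Graph n} c r →
  ProperColouring G c → Robust G (colourClass c (c r))
colourClass-robust {G = G} c r proper H H⊆G connH =
  independent∧dominating⇒maximal {G = H}
    (colourClass-independent {G = H} c (c r) properH)
    (colourClass-dominating c r connH properH)
  where
  properH : ProperColouring H c
  properH = ProperColouring-⊆ {H = H} {G} H⊆G proper

lemma4 : (n : ℕ) (G : Graph n) → Connected G → Bipartite G →
    Σ (VSet n) λ S → Robust G S
lemma4 zero    G _ _            = (λ ()) , λ H _ _ →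
  independent∧dominating⇒maximal {G = H} (λ ()) (λ ())
lemma4 (suc n) G _ (c , proper) = colourClass c (c zero) , colourClass-robust {G = G} c zero proper
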